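{- Let $k$ be a positive integer and $m\ge 0$ an integer with $k\geq 5m+1$. Then $va_3^{\equiv}(K_{4k+1,4k+1,4k+1})\leq 3k-3m$.
   Context: All graphs are finite and simple. A $t$-coloring of a graph $G$ is a map $f:V(G)\to\{1,\dots,t\}$, with color classes $V_i=\{v: f(v)=i\}$. It is equitable if $\big||V_i|-|V_j|\big|\le 1$ for all $i,j$. A $(t,k)$-tree-coloring of $G$ is a $t$-coloring such that every connected component of each induced subgraph $G[V_i]$ is a tree of maximum degree at most $k$; an equitable $(t,k)$-tree-coloring is a $(t,k)$-tree-coloring that is equitable. The strong equitable vertex $k$-arboricity $va_k^{\equiv}(G)$ is the smallest integer $t$ such that $G$ has an equitable $(t',k)$-tree-coloring for every integer $t'\ge t$. $K_{n,n,n}$ denotes the complete tripartite graph whose three partite sets each have exactly $n$ vertices. -}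

module Defs where

open import Level using (0ℓ)
open import Data.Nat using (ℕ; zero; suc; _+_; _≤_)
open import Data.Fin using (Fin; zero; suc; inject₁; fromℕ; _≟_)
open import Data.Product using (_×_; _,_; Σ; ∃; ∃-syntax)
open import Data.List using (List; length; filter; allFin; cartesianProduct)
open import Data.List.Membership.Propositional using (_∈_)
open import Data.List.Relation.Unary.Unique.Propositional using (Unique)
open import Function.Definitions using (Injective)
open import Relation.Nullary using (¬_)
open import Relation.Binary.PropositionalEquality using (_≡_)

record Graph : Set₁ where
  field
    V        : Set
    Adj      : V → V → Set
    sym      : ∀ {u v} → Adj u v → Adj v u
    irrefl   : ∀ {v} → ¬ Adj v v
    vertices : List V
    complete : ∀ v → v ∈ vertices
    unique   : Unique vertices

module _ (G : Graph) where
  open Graph G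

  Coloring : ℕ → Set
  Coloring t = V → Fin t

  classSize : ∀ {t} → Coloring t → Fin t → ℕ
  classSize f i = length (filter (λ v → f v ≟ i) vertices)

  Equitable : ∀ {t} → Coloring t → Set
  Equitable {t} f = ∀ (i j : Fin t) → classSize f i ≤ classSize f j + 1

  MonochromaticCycle : ∀ {t} → Coloring t → Set
  MonochromaticCycle f =
    Σ ℕ λ m → Σ (Fin (3 + m) → V) λ c →
      Injective _≡_ _≡_ c
      × (∀ (i : Fin (2 + m)) → Adj (c (inject₁ i)) (c (suc i)))
      × Adj (c (fromℕ (2 + m))) (c zero)
      × (∀ i → f (c i) ≡ f (c zero))

  DegreeExceeds : ∀ {t} → Coloring t → ℕ → V → Set
  DegreeExceeds f k v =
    Σ (Fin (suc k) → V) λ w →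
      Injective _≡_ _≡_ w × (∀ i → Adj v (w i) × f (w i) ≡ f v)

  -- (t,k)-tree-coloring: every component of every G[V_i] is a tree
  -- (i.e. each G[V_i] is acyclic) of maximum degree at most k
  TreeColoring : ∀ {t} → Coloring t → ℕ → Set
  TreeColoring f k = ¬ MonochromaticCycle f × (∀ v → ¬ DegreeExceeds f k v)

  HasEquitableTreeColoring : ℕ → ℕ → Set
  HasEquitableTreeColoring t k = ∃[ f ] (Equitable {t} f × TreeColoring f k)

  StrongEquitableFrom : ℕ → ℕ → Set
  StrongEquitableFrom k t = ∀ t' → t ≤ t' → HasEquitableTreeColoring t' k

  -- va_k^≡(G) ≤ s  (va_k^≡ is the least t with StrongEquitableFrom k t)
  StrongEquitableVertexArboricity≤ : ℕ → ℕ → Set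
  StrongEquitableVertexArboricity≤ k s = ∃[ t ] (t ≤ s × StrongEquitableFrom k t)

K₃ : ℕ → Graph
K₃ n = record
  { V        = Fin 3 × Fin n
  ; Adj      = λ u v → ¬ (Data.Product.proj₁ u ≡ Data.Product.proj₁ v)
  ; sym      = λ ne eq → ne (Relation.Binary.PropositionalEquality.sym eq)
  ; irrefl   = λ ne → ne Relation.Binary.PropositionalEquality.refl
  ; vertices = cartesianProduct (allFin 3) (allFin n)
  ; complete = λ { (a , b) → Data.List.Membership.Propositional.Properties.∈-cartesianProduct⁺
                               (Data.List.Membership.Propositional.Properties.∈-allFin a)
                               (Data.List.Membership.Propositional.Properties.∈-allFin b) }
  ; unique   = Data.List.Relation.Unary.Unique.Propositional.Properties.cartesianProduct⁺
                 (Data.List.Relation.Unary.Unique.Propositional.Properties.allFin⁺ 3)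
                 (Data.List.Relation.Unary.Unique.Propositional.Properties.allFin⁺ n)
  }
  where
  import Data.Product
  import Data.List.Membership.Propositional.Properties
  import Data.List.Relation.Unary.Unique.Propositional.Properties
  import Relation.Binary.PropositionalEquality

module Submission where

-- Number the 3n vertices of K_{n,n,n}, n = 4k + 1, part after part and cut the sequence into t
-- consecutive blocks of sizes q and q + 1, one block per color, so the coloring is equitable.
-- A block inside one part is independent, and a block of at most four vertices that meets one of
-- the two parts it touches in a single vertex induces a star; either way it is a forest of maximum
-- degree at most 3.
-- For 3k − 3m ≤ t ≤ 3k write 3k − t = g₀ + g₁ + g₂ with all gᵢ ≤ m, and cut part i on its own into
-- k − gᵢ blocks: k − 1 − 5gᵢ of size 4 and 4gᵢ + 1 of size 5 (possible because k ≥ 5m + 1).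
-- For t > 3k we have q = ⌊3n/t⌋ ≤ 3. If q = 3, at most 2k blocks of size 4 come first, at positions
-- 4j, so that their middle point 4j + 2 is never a part boundary; the blocks of size 3 follow, and
-- any remaining blocks of size 4 lie beyond the last boundary 2n.

open import Defs
open import Data.Nat using (ℕ; zero; suc; _+_; _*_; _∸_; _≤_; _<_; _≤?_; _<?_; _≟_; s≤s; z≤n; z<s; s≤s⁻¹)
open import Data.Nat.Properties
open import Data.Nat.DivMod using (_/_; _%_; m≡m%n+[m/n]*n; m%n<n; m<n*o⇒m/o<n)
open import Data.Nat.ListAction using (sum)
open import Data.Nat.ListAction.Properties using (sum-++)
open import Data.Nat.Tactic.RingSolver using (solve-∀)
open import Data.Fin as Fin using (Fin; zero; suc; toℕ; fromℕ<)
import Data.Fin.Properties as Finₚ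
open import Data.List using (List; []; _∷_; _++_; length; map; filter; lookup; replicate; upTo; applyUpTo; tabulate; allFin)
open import Data.List.Properties
  using (length-++; length-replicate; filter-++; filter-all; filter-none; filter-≐; length-upTo; map-upTo;
         map-++; map-∘; map-tabulate; ++-assoc; ++-identityʳ)
open import Data.List.Relation.Unary.All as All using (All; []; _∷_)
open import Data.List.Relation.Unary.All.Properties using (all-upTo; applyUpTo⁺₂; ++⁺; replicate⁺)
open import Data.List.Membership.Propositional.Properties using (∈-lookup)
open import Data.Product using (Σ; ∃₂; _×_; _,_; proj₁; proj₂)
open import Data.Sum using (_⊎_; inj₁; inj₂; swap)
open import Data.Unit using (⊤; tt)
open import Data.Empty using (⊥; ⊥-elim)
open import Function using (_∘_; id)
open import Function.Definitions using (Injective)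
open import Relation.Nullary using (¬_; Dec; yes; no)
open import Relation.Nullary.Decidable using (_×-dec_)
open import Relation.Unary using (_≐_)
open import Relation.Binary.Definitions using (tri<; tri≈; tri>)
open import Relation.Binary.PropositionalEquality

-- Star-shaped color classes

module _ (G : Graph) where
  open Graph G using (V; Adj; irrefl)

  Adj⇒≢ : ∀ {u v} → Adj u v → u ≢ v
  Adj⇒≢ e refl = irrefl e

  Independent : (V → Set) → Set
  Independent C = ∀ {u v} → C u → C v → ¬ Adj u v

  AtMost : ℕ → (V → Set) → Set
  AtMost k C = (z : Fin (suc k) → V) → Injective _≡_ _≡_ z → ¬ (∀ j → C (z j))

  -- The hub is a predicate satisfied by at most one vertex, so it never has to be exhibited.
  record SmallStar (C : V → Set) : Set₁ where
    field
      Hub        : V → Set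
      hub-unique : ∀ {x y} → Hub x → Hub y → x ≡ y
      hub-covers : ∀ {u v} → C u → C v → Adj u v → Hub u ⊎ Hub v
      atMost4    : AtMost 4 C

  StarClass : (V → Set) → Set₁
  StarClass C = Independent C ⊎ SmallStar C

  StarClass-⊆ : ∀ {C D} → (∀ {v} → C v → D v) → StarClass D → StarClass C
  StarClass-⊆ C⊆D (inj₁ indep) = inj₁ λ cu cv → indep (C⊆D cu) (C⊆D cv)
  StarClass-⊆ C⊆D (inj₂ star)  = inj₂ record
    { Hub        = Hub
    ; hub-unique = hub-unique
    ; hub-covers = λ cu cv → hub-covers (C⊆D cu) (C⊆D cv)
    ; atMost4    = λ z z-inj inC → atMost4 z z-inj (λ j → C⊆D (inC j))
    }
    where open SmallStar star

  walk₃-backtracks : ∀ {C u₀ u₁ u₂ u₃} → StarClass C → C u₀ → C u₁ → C u₂ → C u₃ →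
                     Adj u₀ u₁ → Adj u₁ u₂ → Adj u₂ u₃ → u₀ ≡ u₂ ⊎ u₁ ≡ u₃
  walk₃-backtracks (inj₁ indep) c₀ c₁ _ _ e₀₁ _ _ = ⊥-elim (indep c₀ c₁ e₀₁)
  walk₃-backtracks {u₀ = u₀} {u₁} {u₂} {u₃} (inj₂ star) c₀ c₁ c₂ c₃ e₀₁ e₁₂ e₂₃ =
    hubs (hub-covers c₀ c₁ e₀₁) (hub-covers c₁ c₂ e₁₂) (hub-covers c₂ c₃ e₂₃)
    where
    open SmallStar star
    hubs : Hub u₀ ⊎ Hub u₁ → Hub u₁ ⊎ Hub u₂ → Hub u₂ ⊎ Hub u₃ → u₀ ≡ u₂ ⊎ u₁ ≡ u₃
    hubs (inj₁ h₀) (inj₁ h₁) _         = ⊥-elim (Adj⇒≢ e₀₁ (hub-unique h₀ h₁))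
    hubs (inj₁ h₀) (inj₂ h₂) _         = inj₁ (hub-unique h₀ h₂)
    hubs (inj₂ h₁) _         (inj₁ h₂) = ⊥-elim (Adj⇒≢ e₁₂ (hub-unique h₁ h₂))
    hubs (inj₂ h₁) _         (inj₂ h₃) = inj₂ (hub-unique h₁ h₃)

  degree≤3 : ∀ {C v} → StarClass C → C v → (w : Fin 4 → V) → Injective _≡_ _≡_ w →
             ¬ (∀ i → Adj v (w i) × C (w i))
  degree≤3 (inj₁ indep) cv w _ hw = indep cv (proj₂ (hw zero)) (proj₁ (hw zero))
  degree≤3 {C} {v} (inj₂ star) cv w w-inj hw = SmallStar.atMost4 star closedNbhd closedNbhd-injective inC
    where
    closedNbhd : Fin 5 → V
    closedNbhd zero    = v
    closedNbhd (suc i) = w i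
    closedNbhd-injective : Injective _≡_ _≡_ closedNbhd
    closedNbhd-injective {zero}  {zero}  _ = refl
    closedNbhd-injective {zero}  {suc j} e = ⊥-elim (Adj⇒≢ (proj₁ (hw j)) e)
    closedNbhd-injective {suc i} {zero}  e = ⊥-elim (Adj⇒≢ (proj₁ (hw i)) (sym e))
    closedNbhd-injective {suc i} {suc j} e = cong suc (w-inj e)
    inC : ∀ j → C (closedNbhd j)
    inC zero    = cv
    inC (suc i) = proj₂ (hw i)

  starClasses⇒treeColoring : ∀ {t} (f : Coloring G t) → (∀ i → StarClass (λ v → f v ≡ i)) →
                             TreeColoring G f 3
  starClasses⇒treeColoring f star = acyclic , λ v (w , w-inj , hw) → degree≤3 (star (f v)) refl w w-inj hw
    where
    acyclic : ¬ MonochromaticCycle G f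
    acyclic (zero , c , c-inj , adj , adjLast , mono)
      with walk₃-backtracks (star _) (mono zero) (mono (suc zero)) (mono (suc (suc zero))) (mono zero)
                            (adj zero) (adj (suc zero)) adjLast
    ... | inj₁ e with () ← c-inj e
    ... | inj₂ e with () ← c-inj e
    acyclic (suc _ , c , c-inj , adj , _ , mono)
      with walk₃-backtracks (star _) (mono zero) (mono (suc zero)) (mono (suc (suc zero))) (mono (suc (suc (suc zero))))
                            (adj zero) (adj (suc zero)) (adj (suc (suc zero)))
    ... | inj₁ e with () ← c-inj e
    ... | inj₂ e with () ← c-inj e

  twoSizes⇒equitable : ∀ {t} (f : Coloring G t) q →
                       (∀ i → classSize G f i ≡ q ⊎ classSize G f i ≡ suc q) → Equitable G f
  twoSizes⇒equitable f q sizes i j = begin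
    classSize G f i      ≤⟨ at-most (sizes i) ⟩
    suc q                ≡⟨ +-comm 1 q ⟩
    q + 1                ≤⟨ +-monoˡ-≤ 1 (at-least (sizes j)) ⟩
    classSize G f j + 1  ∎
    where
    open ≤-Reasoning
    at-most : ∀ {x} → x ≡ q ⊎ x ≡ suc q → x ≤ suc q
    at-most (inj₁ refl) = n≤1+n q
    at-most (inj₂ refl) = ≤-refl
    at-least : ∀ {x} → x ≡ q ⊎ x ≡ suc q → q ≤ x
    at-least (inj₁ refl) = ≤-refl
    at-least (inj₂ refl) = n≤1+n q

-- Counting and consecutive blocks

applyUpTo-+ : ∀ {A : Set} (f : ℕ → A) m n → applyUpTo f (m + n) ≡ applyUpTo f m ++ applyUpTo (λ i → f (m + i)) n
applyUpTo-+ f zero    n = refl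
applyUpTo-+ f (suc m) n = cong (f 0 ∷_) (applyUpTo-+ (f ∘ suc) m n)

tabulate-toℕ : ∀ {A : Set} n (f : ℕ → A) → tabulate (λ (x : Fin n) → f (toℕ x)) ≡ applyUpTo f n
tabulate-toℕ zero    f = refl
tabulate-toℕ (suc n) f = cong (f 0 ∷_) (tabulate-toℕ n (f ∘ suc))

count : ∀ {A : Set} {P : A → Set} → (∀ x → Dec (P x)) → List A → ℕ
count P? xs = length (filter P? xs)

module _ {A : Set} {P : A → Set} (P? : ∀ x → Dec (P x)) where

  count-map : ∀ {B : Set} (g : B → A) xs → count P? (map g xs) ≡ count (P? ∘ g) xs
  count-map g []       = refl
  count-map g (x ∷ xs) with P? (g x)
  ... | yes _ = cong suc (count-map g xs)
  ... | no  _ = count-map g xs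

  count-++ : ∀ xs ys → count P? (xs ++ ys) ≡ count P? xs + count P? ys
  count-++ xs ys = trans (cong length (filter-++ P? xs ys)) (length-++ (filter P? xs))

  count-all : ∀ {xs} → All P xs → count P? xs ≡ length xs
  count-all Pxs = cong length (filter-all P? Pxs)

  count-none : ∀ {xs} → All (¬_ ∘ P) xs → count P? xs ≡ 0
  count-none ¬Pxs = cong length (filter-none P? ¬Pxs)

module _ {P : ℕ → Set} (P? : ∀ x → Dec (P x)) where

  count-upTo-+ : ∀ m n → count P? (upTo (m + n)) ≡ count P? (upTo m) + count (λ j → P? (m + j)) (upTo n)
  count-upTo-+ m n = begin
    count P? (upTo (m + n))                              ≡⟨ cong (count P?) (applyUpTo-+ id m n) ⟩
    count P? (upTo m ++ applyUpTo (m +_) n)              ≡⟨ count-++ P? (upTo m) _ ⟩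
    count P? (upTo m) + count P? (applyUpTo (m +_) n)    ≡⟨ cong (λ xs → count P? (upTo m) + count P? xs) (map-upTo (m +_) n) ⟨
    count P? (upTo m) + count P? (map (m +_) (upTo n))   ≡⟨ cong (count P? (upTo m) +_) (count-map P? (m +_) (upTo n)) ⟩
    count P? (upTo m) + count (λ j → P? (m + j)) (upTo n) ∎
    where open ≡-Reasoning

-- Positions j ≥ sum L are sent to length L.
blockOf : List ℕ → ℕ → ℕ
blockOf []      j = 0
blockOf (s ∷ L) j with j <? s
... | yes _ = 0
... | no  _ = suc (blockOf L (j ∸ s))

blockOf-head : ∀ {s L j} → j < s → blockOf (s ∷ L) j ≡ 0
blockOf-head {s} {L} {j} j<s with j <? s
... | yes _   = refl
... | no  j≮s = ⊥-elim (j≮s j<s)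

blockOf-shift : ∀ s L j → blockOf (s ∷ L) (s + j) ≡ suc (blockOf L j)
blockOf-shift s L j with s + j <? s
... | yes s+j<s = ⊥-elim (m+n≮m s j s+j<s)
... | no  _     = cong (suc ∘ blockOf L) (m+n∸m≡n s j)

blockOf-< : ∀ L {j} → j < sum L → blockOf L j < length L
blockOf-< (s ∷ L) {j} j<sum with j <? s
... | yes _   = s≤s z≤n
... | no  j≮s = s≤s (blockOf-< L (+-cancelˡ-< s _ _ (subst (_< s + sum L) (sym (m+[n∸m]≡n (≮⇒≥ j≮s))) j<sum)))

blockOf≟ : ∀ L c j → Dec (blockOf L j ≡ c)
blockOf≟ L c j = blockOf L j ≟ c

count-blockOf : ∀ L (i : Fin (length L)) → count (blockOf≟ L (toℕ i)) (upTo (sum L)) ≡ lookup L i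
count-blockOf (s ∷ L) zero = begin
    count (blockOf≟ (s ∷ L) 0) (upTo (s + sum L))
  ≡⟨ count-upTo-+ _ s (sum L) ⟩
    count (blockOf≟ (s ∷ L) 0) (upTo s) + count (blockOf≟ (s ∷ L) 0 ∘ (s +_)) (upTo (sum L))
  ≡⟨ cong₂ _+_ (count-all _ (All.map blockOf-head (all-upTo s)))
               (count-none _ (applyUpTo⁺₂ id (sum L) λ j e → 1+n≢0 (trans (sym (blockOf-shift s L j)) e))) ⟩
    length (upTo s) + 0
  ≡⟨ trans (+-identityʳ _) (length-upTo s) ⟩
    s ∎
  where open ≡-Reasoning
count-blockOf (s ∷ L) (suc i) = begin
    count (blockOf≟ (s ∷ L) c) (upTo (s + sum L))
  ≡⟨ count-upTo-+ _ s (sum L) ⟩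
    count (blockOf≟ (s ∷ L) c) (upTo s) + count (blockOf≟ (s ∷ L) c ∘ (s +_)) (upTo (sum L))
  ≡⟨ cong₂ _+_ (count-none _ (All.map (λ j<s e → 0≢1+n (trans (sym (blockOf-head j<s)) e)) (all-upTo s)))
               (cong length (filter-≐ _ _ shift (upTo (sum L)))) ⟩
    count (blockOf≟ L (toℕ i)) (upTo (sum L))
  ≡⟨ count-blockOf L i ⟩
    lookup L i ∎
  where
  open ≡-Reasoning
  c = suc (toℕ i)
  shift : (λ j → blockOf (s ∷ L) (s + j) ≡ c) ≐ (λ j → blockOf L j ≡ toℕ i)
  shift = (λ {j} e → suc-injective (trans (sym (blockOf-shift s L j)) e))
        , (λ {j} e → trans (blockOf-shift s L j) (cong suc e))

AllBlocks : (ℕ → ℕ → Set) → ℕ → List ℕ → Set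
AllBlocks P a []      = ⊤
AllBlocks P a (s ∷ L) = P a s × AllBlocks P (a + s) L

blockOf-interval : ∀ {P} {off} L (i : Fin (length L)) → AllBlocks P off L →
                   Σ ℕ λ a → P (off + a) (lookup L i) × (∀ {j} → blockOf L j ≡ toℕ i → a ≤ j × j < a + lookup L i)
blockOf-interval {P} {off} (s ∷ L) zero (Ps , _) = 0 , subst (λ a → P a s) (sym (+-identityʳ off)) Ps , inHead
  where
  inHead : ∀ {j} → blockOf (s ∷ L) j ≡ 0 → 0 ≤ j × j < s
  inHead {j} e with j <? s
  ... | yes j<s = z≤n , j<s
blockOf-interval {P} {off} (s ∷ L) (suc i) (_ , PL) with blockOf-interval L i PL
... | a , Pa , inBlock = s + a , subst (λ x → P x (lookup L i)) (+-assoc off s a) Pa , inTail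
  where
  inTail : ∀ {j} → blockOf (s ∷ L) j ≡ suc (toℕ i) → s + a ≤ j × j < s + a + lookup L i
  inTail {j} e with j <? s
  ... | no j≮s = let s≤j = ≮⇒≥ j≮s ; (a≤ , <a+) = inBlock (suc-injective e) in
    subst (s + a ≤_) (m+[n∸m]≡n s≤j) (+-monoʳ-≤ s a≤) ,
    subst₂ _<_ (m+[n∸m]≡n s≤j) (sym (+-assoc s a _)) (+-monoʳ-< s <a+)

-- The vertices of K_{n,n,n} as an interval

Vertex : ℕ → Set
Vertex n = Fin 3 × Fin n

offset : ∀ n → Fin 3 → ℕ
offset n zero             = 0
offset n (suc zero)       = n
offset n (suc (suc zero)) = n + n

idx : ∀ n → Vertex n → ℕ
idx n (p , x) = offset n p + toℕ x

Boundary : ℕ → ℕ → Set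
Boundary n b = b ≡ n ⊎ b ≡ n + n

offset-< : ∀ n {p p'} → p Fin.< p' → Boundary n (offset n p') × offset n p + n ≤ offset n p'
offset-< n {zero}        {suc zero}       _ = inj₁ refl , ≤-refl
offset-< n {zero}        {suc (suc zero)} _ = inj₂ refl , m≤m+n n n
offset-< n {suc zero}    {suc (suc zero)} _ = inj₂ refl , ≤-refl
offset-< n {suc _}       {suc zero}       (s≤s ())
offset-< n {suc (suc _)} {suc (suc zero)} (s≤s (s≤s ()))

idx<offset+n : ∀ n (v : Vertex n) → idx n v < offset n (proj₁ v) + n
idx<offset+n n (p , x) = +-monoʳ-< (offset n p) (Finₚ.toℕ<n x)

Separates : ℕ → ℕ → ℕ → Set
Separates b i j = i < b × b ≤ j ⊎ j < b × b ≤ i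

different-parts-separated : ∀ n (u v : Vertex n) → proj₁ u ≢ proj₁ v →
                            Σ ℕ λ b → Boundary n b × Separates b (idx n u) (idx n v)
different-parts-separated n u@(p , _) v@(p' , _) p≢p' with Finₚ.<-cmp p p'
... | tri< p<p' _ _ = let (bd , le) = offset-< n p<p' in
      offset n p' , bd , inj₁ (<-≤-trans (idx<offset+n n u) le , m≤m+n _ _)
... | tri≈ _ p≡p' _ = ⊥-elim (p≢p' p≡p')
... | tri> _ _ p'<p = let (bd , le) = offset-< n p'<p in
      offset n p , bd , inj₂ (<-≤-trans (idx<offset+n n v) le , m≤m+n _ _)

idx-injective : ∀ n {u v : Vertex n} → idx n u ≡ idx n v → u ≡ v
idx-injective n {p , x} {p' , x'} e with p Fin.≟ p'
... | yes refl = cong (p ,_) (Finₚ.toℕ-injective (+-cancelˡ-≡ (offset n p) _ _ e))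
... | no p≢p' with different-parts-separated n (p , x) (p' , x') p≢p'
...   | _ , _ , inj₁ (i<b , b≤j) = ⊥-elim (<-irrefl e (<-≤-trans i<b b≤j))
...   | _ , _ , inj₂ (j<b , b≤i) = ⊥-elim (<-irrefl (sym e) (<-≤-trans j<b b≤i))

idx<3n : ∀ n (v : Vertex n) → idx n v < (n + n) + n
idx<3n n v@(p , _) = <-≤-trans (idx<offset+n n v) (last p)
  where
  last : ∀ p → offset n p + n ≤ (n + n) + n
  last zero             = m≤n+m n (n + n)
  last (suc zero)       = m≤m+n (n + n) n
  last (suc (suc zero)) = ≤-refl

idx-enumerates : ∀ n → map (idx n) (Graph.vertices (K₃ n)) ≡ upTo ((n + n) + n)
idx-enumerates n = begin
    map (idx n) (part zero ++ (part (suc zero) ++ (part (suc (suc zero)) ++ [])))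
  ≡⟨ trans (map-++ (idx n) (part zero) _) (cong (map (idx n) (part zero) ++_)
       (trans (map-++ (idx n) (part (suc zero)) _) (cong (map (idx n) (part (suc zero)) ++_)
         (trans (map-++ (idx n) (part (suc (suc zero))) []) (++-identityʳ _))))) ⟩
    indices zero ++ (indices (suc zero) ++ indices (suc (suc zero)))
  ≡⟨ cong₂ _++_ (part-indices zero) (cong₂ _++_ (part-indices (suc zero)) (part-indices (suc (suc zero)))) ⟩
    upTo n ++ (applyUpTo (n +_) n ++ applyUpTo ((n + n) +_) n)
  ≡⟨ ++-assoc (upTo n) _ _ ⟨
    (upTo n ++ applyUpTo (n +_) n) ++ applyUpTo ((n + n) +_) n
  ≡⟨ cong (_++ applyUpTo ((n + n) +_) n) (applyUpTo-+ id n n) ⟨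
    upTo (n + n) ++ applyUpTo ((n + n) +_) n
  ≡⟨ applyUpTo-+ id (n + n) n ⟨
    upTo ((n + n) + n) ∎
  where
  open ≡-Reasoning
  part : Fin 3 → List (Vertex n)
  part p = map (p ,_) (allFin n)
  indices : Fin 3 → List ℕ
  indices p = map (idx n) (part p)
  part-indices : ∀ p → indices p ≡ applyUpTo (offset n p +_) n
  part-indices p = trans (sym (map-∘ (allFin n))) (trans (map-tabulate id _) (tabulate-toℕ n (offset n p +_)))

InBlock : ∀ n → ℕ → ℕ → Vertex n → Set
InBlock n a s v = a ≤ idx n v × idx n v < a + s

Inside : ℕ → ℕ → ℕ → Set
Inside a s b = a < b × b < a + s

-- A boundary next to an end of the block leaves a single vertex on one side: the hub of a star.
StarBlock : ℕ → ℕ → ℕ → Set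
StarBlock n a s = ∀ b → Boundary n b → Inside a s b → s ≤ 4 × (b ≡ suc a ⊎ suc b ≡ a + s)

boundary-unique : ∀ {n a s b b'} → s ≤ n → Boundary n b → Boundary n b' → Inside a s b → Inside a s b' → b ≡ b'
boundary-unique _   (inj₁ refl) (inj₁ refl) _ _ = refl
boundary-unique _   (inj₂ refl) (inj₂ refl) _ _ = refl
boundary-unique s≤n (inj₁ refl) (inj₂ refl) (a<n , _) (_ , 2n<a+s) = ⊥-elim (both-inside s≤n a<n 2n<a+s)
  where
  both-inside : ∀ {n a s} → s ≤ n → a < n → n + n < a + s → ⊥
  both-inside {n} {a} {s} s≤n a<n 2n<a+s = <-irrefl refl (begin-strict
    n + n  <⟨ 2n<a+s ⟩
    a + s  ≤⟨ +-monoʳ-≤ a s≤n ⟩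
    a + n  <⟨ +-monoˡ-< n a<n ⟩
    n + n  ∎)
    where open ≤-Reasoning
boundary-unique s≤n (inj₂ refl) (inj₁ refl) i i' = sym (boundary-unique s≤n (inj₁ refl) (inj₂ refl) i' i)

separated-inside : ∀ {a s b i j} → a ≤ i → i < a + s → a ≤ j → j < a + s → Separates b i j → Inside a s b
separated-inside a≤i _ _ j<a+s (inj₁ (i<b , b≤j)) = ≤-<-trans a≤i i<b , ≤-<-trans b≤j j<a+s
separated-inside _ i<a+s a≤j _ (inj₂ (j<b , b≤i)) = ≤-<-trans a≤j j<b , ≤-<-trans b≤i i<a+s

endpoint : ∀ {a s b} → b ≡ suc a ⊎ suc b ≡ a + s → ℕ
endpoint {a}     (inj₁ _) = a
endpoint {b = b} (inj₂ _) = b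

crossing-at-endpoint : ∀ {a s b i j} (side : b ≡ suc a ⊎ suc b ≡ a + s) →
                       a ≤ i → i < b → b ≤ j → j < a + s → i ≡ endpoint side ⊎ j ≡ endpoint side
crossing-at-endpoint (inj₁ refl)      a≤i i<b _   _     = inj₁ (≤-antisym (s≤s⁻¹ i<b) a≤i)
crossing-at-endpoint {j = j} (inj₂ e) _   _   b≤j j<a+s = inj₂ (≤-antisym (s≤s⁻¹ (subst (j <_) (sym e) j<a+s)) b≤j)

inBlock-atMost : ∀ {n a s k} → s ≤ k → AtMost (K₃ n) k (InBlock n a s)
inBlock-atMost {n} {a} {s} {k} s≤k z z-injective inBlock = collision (Finₚ.pigeonhole (n<1+n k) slot)
  where
  slot< : ∀ j → idx n (z j) ∸ a < k
  slot< j = <-≤-trans (subst (idx n (z j) ∸ a <_) (m+n∸m≡n a s) (∸-monoˡ-< (proj₂ (inBlock j)) (proj₁ (inBlock j)))) s≤k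
  slot : Fin (suc k) → Fin k
  slot j = fromℕ< (slot< j)
  collision : ∃₂ (λ i j → i Fin.< j × slot i ≡ slot j) → ⊥
  collision (i , j , i<j , same) = Finₚ.<-irrefl (z-injective (idx-injective n (begin
      idx n (z i)               ≡⟨ m∸n+n≡m (proj₁ (inBlock i)) ⟨
      (idx n (z i) ∸ a) + a     ≡⟨ cong (_+ a) (trans (sym (Finₚ.toℕ-fromℕ< (slot< i)))
                                                 (trans (cong toℕ same) (Finₚ.toℕ-fromℕ< (slot< j)))) ⟩
      (idx n (z j) ∸ a) + a     ≡⟨ m∸n+n≡m (proj₁ (inBlock j)) ⟩
      idx n (z j)               ∎))) i<j
    where open ≡-Reasoning

inside? : ∀ a s b → Dec (Inside a s b)
inside? a s b = (a <? b) ×-dec (b <? a + s)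

module _ {n a s : ℕ} where

  edge-separated : ∀ {u v} → InBlock n a s u → InBlock n a s v → Graph.Adj (K₃ n) u v →
                   Σ ℕ λ b → Boundary n b × Inside a s b × Separates b (idx n u) (idx n v)
  edge-separated {u} {v} (a≤u , u<) (a≤v , v<) adj with different-parts-separated n u v adj
  ... | b , bd , sep = b , bd , separated-inside a≤u u< a≤v v< sep , sep

  boundaryFree⇒independent : (∀ b → Boundary n b → ¬ Inside a s b) → Independent (K₃ n) (InBlock n a s)
  boundaryFree⇒independent free inU inV adj with edge-separated inU inV adj
  ... | b , bd , inside , _ = free b bd inside

  boundaryInside⇒smallStar : ∀ {b} → 4 ≤ n → StarBlock n a s → Boundary n b → Inside a s b →
                             SmallStar (K₃ n) (InBlock n a s)
  boundaryInside⇒smallStar {b} 4≤n star bd inside = record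
    { Hub        = λ v → idx n v ≡ endpoint side
    ; hub-unique = λ hx hy → idx-injective n (trans hx (sym hy))
    ; hub-covers = covers
    ; atMost4    = inBlock-atMost s≤4
    }
    where
    s≤4  = proj₁ (star b bd inside)
    side = proj₂ (star b bd inside)
    covers : ∀ {u v} → InBlock n a s u → InBlock n a s v → Graph.Adj (K₃ n) u v →
             idx n u ≡ endpoint side ⊎ idx n v ≡ endpoint side
    covers inU@(a≤u , u<) inV@(a≤v , v<) adj with edge-separated inU inV adj
    ... | b' , bd' , inside' , sep with boundary-unique (≤-trans s≤4 4≤n) bd' bd inside' inside
    ...   | refl with sep
    ...     | inj₁ (u<b , b≤v) = crossing-at-endpoint side a≤u u<b b≤v v<
    ...     | inj₂ (v<b , b≤u) = swap (crossing-at-endpoint side a≤v v<b b≤u u<)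

starBlock⇒starClass : ∀ {n a s} → 4 ≤ n → StarBlock n a s → StarClass (K₃ n) (InBlock n a s)
starBlock⇒starClass {n} {a} {s} 4≤n star with inside? a s n | inside? a s (n + n)
... | yes inside | _           = inj₂ (boundaryInside⇒smallStar 4≤n star (inj₁ refl) inside)
... | no  _      | yes inside  = inj₂ (boundaryInside⇒smallStar 4≤n star (inj₂ refl) inside)
... | no  ¬in₁   | no  ¬in₂    = inj₁ (boundaryFree⇒independent λ { b (inj₁ refl) → ¬in₁ ; b (inj₂ refl) → ¬in₂ })

-- Colorings by consecutive blocks

module _ (n : ℕ) (L : List ℕ) (total : sum L ≡ (n + n) + n) where

  blockColoring : Coloring (K₃ n) (length L)
  blockColoring v = fromℕ< (blockOf-< L (subst (idx n v <_) (sym total) (idx<3n n v)))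

  toℕ-blockColoring : ∀ v → toℕ (blockColoring v) ≡ blockOf L (idx n v)
  toℕ-blockColoring v = Finₚ.toℕ-fromℕ< _

  classSize-blockColoring : ∀ i → classSize (K₃ n) blockColoring i ≡ lookup L i
  classSize-blockColoring i = begin
      count (λ v → blockColoring v Fin.≟ i) (Graph.vertices (K₃ n))
    ≡⟨ cong length (filter-≐ _ _ same-class (Graph.vertices (K₃ n))) ⟩
      count (λ v → blockOf≟ L (toℕ i) (idx n v)) (Graph.vertices (K₃ n))
    ≡⟨ count-map (blockOf≟ L (toℕ i)) (idx n) (Graph.vertices (K₃ n)) ⟨
      count (blockOf≟ L (toℕ i)) (map (idx n) (Graph.vertices (K₃ n)))
    ≡⟨ cong (count (blockOf≟ L (toℕ i))) (trans (idx-enumerates n) (cong upTo (sym total))) ⟩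
      count (blockOf≟ L (toℕ i)) (upTo (sum L))
    ≡⟨ count-blockOf L i ⟩
      lookup L i ∎
    where
    open ≡-Reasoning
    same-class : _
    same-class = (λ {v} e → trans (sym (toℕ-blockColoring v)) (cong toℕ e))
               , (λ {v} e → Finₚ.toℕ-injective (trans (toℕ-blockColoring v) e))

  blockColoring-classes : ∀ {P} → AllBlocks P 0 L → ∀ i →
                           Σ ℕ λ a → P a (lookup L i) × (∀ {v} → blockColoring v ≡ i → InBlock n a (lookup L i) v)
  blockColoring-classes {P} blocks i with blockOf-interval L i blocks
  ... | a , Pa , inBlock = a , Pa , λ {v} e → inBlock (trans (sym (toℕ-blockColoring v)) (cong toℕ e))

  equitableTreeColoring : ∀ {q} → 4 ≤ n → All (λ s → s ≡ q ⊎ s ≡ suc q) L → AllBlocks (StarBlock n) 0 L →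
                           HasEquitableTreeColoring (K₃ n) (length L) 3
  equitableTreeColoring {q} 4≤n sizes blocks =
    blockColoring ,
    twoSizes⇒equitable (K₃ n) blockColoring q
      (λ i → subst (λ c → c ≡ q ⊎ c ≡ suc q) (sym (classSize-blockColoring i)) (All.lookup sizes (∈-lookup i))) ,
    starClasses⇒treeColoring (K₃ n) blockColoring λ i →
      let (a , star , ⊆block) = blockColoring-classes blocks i in
      StarClass-⊆ (K₃ n) (λ {v} → ⊆block {v}) (starBlock⇒starClass 4≤n star)

-- Layouts of the blocks

sum-replicate : ∀ c s → sum (replicate c s) ≡ c * s
sum-replicate zero    s = refl
sum-replicate (suc c) s = cong (s +_) (sum-replicate c s)

AllBlocks-++ : ∀ {P off} L₁ {L₂} → AllBlocks P off L₁ → AllBlocks P (off + sum L₁) L₂ →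
               AllBlocks P off (L₁ ++ L₂)
AllBlocks-++ {P} {off} []       {L₂} _          blocks₂ = subst (λ a → AllBlocks P a L₂) (+-identityʳ off) blocks₂
AllBlocks-++ {P} {off} (s ∷ L₁) {L₂} (Ps , blocks₁) blocks₂ =
  Ps , AllBlocks-++ L₁ blocks₁ (subst (λ a → AllBlocks P a L₂) (sym (+-assoc off s (sum L₁))) blocks₂)

AllBlocks-fromAll : ∀ {P : ℕ → ℕ → Set} {Q : ℕ → Set} {off L} → (∀ a {s} → Q s → P a s) → All Q L →
                    AllBlocks P off L
AllBlocks-fromAll P⇐Q []         = tt
AllBlocks-fromAll P⇐Q (Qs ∷ QL) = P⇐Q _ Qs , AllBlocks-fromAll P⇐Q QL

smallBlock-star : ∀ {n a s} → s ≤ 3 → StarBlock n a s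
smallBlock-star {a = a} {s} s≤3 b _ (a<b , b<a+s) = ≤-trans s≤3 (n≤1+n 3) , side (m≤n⇒m<n∨m≡n a<b)
  where
  side : suc a < b ⊎ suc a ≡ b → b ≡ suc a ⊎ suc b ≡ a + s
  side (inj₂ e)      = inj₁ (sym e)
  side (inj₁ 1+a<b)  = inj₂ (≤-antisym b<a+s (begin
    a + s      ≤⟨ +-monoʳ-≤ a s≤3 ⟩
    a + 3      ≡⟨ +-comm a 3 ⟩
    3 + a      ≤⟨ s≤s 1+a<b ⟩
    suc b      ∎))
    where open ≤-Reasoning

AllBlocks-avoiding : ∀ {n} off L → (∀ b → Boundary n b → b ≤ off ⊎ off + sum L ≤ b) →
                     AllBlocks (StarBlock n) off L
AllBlocks-avoiding off []      _     = tt
AllBlocks-avoiding off (s ∷ L) avoid = noneInside , AllBlocks-avoiding (off + s) L avoid′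
  where
  noneInside : StarBlock _ off s
  noneInside b bd (off<b , b<off+s) with avoid b bd
  ... | inj₁ b≤off   = ⊥-elim (<⇒≱ off<b b≤off)
  ... | inj₂ end≤b   = ⊥-elim (<⇒≱ b<off+s (≤-trans (+-monoʳ-≤ off (m≤m+n s (sum L))) end≤b))
  avoid′ : ∀ b → Boundary _ b → b ≤ off + s ⊎ off + s + sum L ≤ b
  avoid′ b bd with avoid b bd
  ... | inj₁ b≤off = inj₁ (≤-trans b≤off (m≤m+n off s))
  ... | inj₂ end≤b = inj₂ (subst (_≤ b) (sym (+-assoc off s (sum L))) end≤b)

fourBlock-star : ∀ {n a} → (∀ b → Boundary n b → b ≢ 2 + a) → StarBlock n a 4
fourBlock-star {a = a} middleFree b bd (a<b , b<a+4) with m≤n⇒m<n∨m≡n a<b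
... | inj₂ refl = ≤-refl , inj₁ refl
... | inj₁ 1+a<b with m≤n⇒m<n∨m≡n 1+a<b
...   | inj₂ refl = ⊥-elim (middleFree b bd refl)
...   | inj₁ 2+a<b = ≤-refl , inj₂ (≤-antisym b<a+4 (subst (_≤ suc b) (+-comm 4 a) (s≤s 2+a<b)))

alignedFours : ∀ k j c → j + c ≤ k + k → AllBlocks (StarBlock (4 * k + 1)) (4 * j) (replicate c 4)
alignedFours k j zero    _         = tt
alignedFours k j (suc c) j+1+c≤2k =
  fourBlock-star middleFree ,
  subst (λ a → AllBlocks (StarBlock (4 * k + 1)) a (replicate c 4)) (next j)
        (alignedFours k (suc j) c (subst (_≤ k + k) (+-suc j c) j+1+c≤2k))
  where
  next : ∀ j → 4 * suc j ≡ 4 * j + 4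
  next = solve-∀
  middleFree : ∀ b → Boundary (4 * k + 1) b → b ≢ 2 + 4 * j
  middleFree _ (inj₁ refl) e = even≢odd (1 + 2 * j) (2 * k) (trans (sym (even j)) (trans (sym e) (odd k)))
    where
    even : ∀ j → 2 + 4 * j ≡ 2 * (1 + 2 * j)
    even = solve-∀
    odd : ∀ k → 4 * k + 1 ≡ suc (2 * (2 * k))
    odd = solve-∀
  middleFree _ (inj₂ refl) e = <-irrefl j≡2k (<-≤-trans (m<m+n j z<s) j+1+c≤2k)
    where
    double : ∀ k → (4 * k + 1) + (4 * k + 1) ≡ 2 + 4 * (k + k)
    double = solve-∀
    j≡2k : j ≡ k + k
    j≡2k = sym (*-cancelˡ-≡ (k + k) j 4 (suc-injective (suc-injective (trans (sym (double k)) e))))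

4≤4k+1 : ∀ {k} → 1 ≤ k → 4 ≤ 4 * k + 1
4≤4k+1 {k} 1≤k = ≤-trans (*-monoʳ-≤ 4 1≤k) (m≤m+n (4 * k) 1)

partTiling : ℕ → ℕ → List ℕ
partTiling k g = replicate (k ∸ (5 * g + 1)) 4 ++ replicate (4 * g + 1) 5

module _ (k g : ℕ) (fits : 5 * g + 1 ≤ k) where

  private
    x = k ∸ (5 * g + 1)

  sum-partTiling : sum (partTiling k g) ≡ 4 * k + 1
  sum-partTiling = begin
    sum (partTiling k g)                    ≡⟨ sum-++ (replicate x 4) _ ⟩
    sum (replicate x 4) + sum (replicate (4 * g + 1) 5) ≡⟨ cong₂ _+_ (sum-replicate x 4) (sum-replicate (4 * g + 1) 5) ⟩
    x * 4 + (4 * g + 1) * 5                 ≡⟨ tiles x g ⟩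
    4 * ((5 * g + 1) + x) + 1               ≡⟨ cong (λ k → 4 * k + 1) (m+[n∸m]≡n fits) ⟩
    4 * k + 1                               ∎
    where
    open ≡-Reasoning
    tiles : ∀ x g → x * 4 + (4 * g + 1) * 5 ≡ 4 * ((5 * g + 1) + x) + 1
    tiles = solve-∀

  length-partTiling : length (partTiling k g) + g ≡ k
  length-partTiling = begin
    length (partTiling k g) + g             ≡⟨ cong (_+ g) (length-++ (replicate x 4)) ⟩
    length (replicate x 4) + length (replicate (4 * g + 1) 5) + g
                                            ≡⟨ cong₂ (λ a b → a + b + g) (length-replicate x) (length-replicate (4 * g + 1)) ⟩
    x + (4 * g + 1) + g                     ≡⟨ blocks x g ⟩
    (5 * g + 1) + x                         ≡⟨ m+[n∸m]≡n fits ⟩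
    k                                       ∎
    where
    open ≡-Reasoning
    blocks : ∀ x g → x + (4 * g + 1) + g ≡ (5 * g + 1) + x
    blocks = solve-∀

partTiling-sizes : ∀ k g → All (λ s → s ≡ 4 ⊎ s ≡ 5) (partTiling k g)
partTiling-sizes k g = ++⁺ (replicate⁺ (k ∸ (5 * g + 1)) (inj₁ refl)) (replicate⁺ (4 * g + 1) (inj₂ refl))

partwise-starBlocks : ∀ {n} L₀ L₁ L₂ → sum L₀ ≡ n → sum L₁ ≡ n →
                      AllBlocks (StarBlock n) 0 (L₀ ++ (L₁ ++ L₂))
partwise-starBlocks L₀ L₁ L₂ refl sum₁ =
  AllBlocks-++ L₀ (AllBlocks-avoiding 0 L₀ after₀)
    (AllBlocks-++ L₁ (AllBlocks-avoiding n L₁ around₁) (AllBlocks-avoiding (n + sum L₁) L₂ before₂))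
  where
  n = sum L₀
  after₀ : ∀ b → Boundary n b → b ≤ 0 ⊎ n ≤ b
  after₀ _ (inj₁ refl) = inj₂ ≤-refl
  after₀ _ (inj₂ refl) = inj₂ (m≤m+n n n)
  around₁ : ∀ b → Boundary n b → b ≤ n ⊎ n + sum L₁ ≤ b
  around₁ _ (inj₁ refl) = inj₁ ≤-refl
  around₁ _ (inj₂ refl) = inj₂ (≤-reflexive (cong (n +_) sum₁))
  before₂ : ∀ b → Boundary n b → b ≤ n + sum L₁ ⊎ n + sum L₁ + sum L₂ ≤ b
  before₂ _ (inj₁ refl) = inj₁ (m≤m+n n (sum L₁))
  before₂ _ (inj₂ refl) = inj₁ (≤-reflexive (cong (n +_) (sym sum₁)))

split≤+ : ∀ {d} m m' → d ≤ m + m' → Σ ℕ λ x → Σ ℕ λ y → x ≤ m × y ≤ m' × x + y ≡ d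
split≤+ {d} m m' d≤m+m' with d ≤? m
... | yes d≤m = d , 0 , d≤m , z≤n , +-identityʳ d
... | no  d≰m = m , d ∸ m , ≤-refl , m≤n+o⇒m∸n≤o d m d≤m+m' , m+[n∸m]≡n (<⇒≤ (≰⇒> d≰m))

split₃ : ∀ {d} m → d ≤ 3 * m →
         Σ ℕ λ g₀ → Σ ℕ λ g₁ → Σ ℕ λ g₂ → g₀ ≤ m × g₁ ≤ m × g₂ ≤ m × g₀ + (g₁ + g₂) ≡ d
split₃ m d≤3m with g₀ , rest , g₀≤m , rest≤2m , g₀+rest≡d ← split≤+ m (m + (m + 0)) d≤3m
              with g₁ , g₂ , g₁≤m , g₂≤m+0 , g₁+g₂≡rest ← split≤+ m (m + 0) rest≤2m
  = g₀ , g₁ , g₂ , g₀≤m , g₁≤m , subst (g₂ ≤_) (+-identityʳ m) g₂≤m+0 ,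
    trans (cong (g₀ +_) g₁+g₂≡rest) g₀+rest≡d

partTilings-coloring : ∀ {k g₀ g₁ g₂} → 5 * g₀ + 1 ≤ k → 5 * g₁ + 1 ≤ k → 5 * g₂ + 1 ≤ k →
                        HasEquitableTreeColoring (K₃ (4 * k + 1)) (3 * k ∸ (g₀ + (g₁ + g₂))) 3
partTilings-coloring {k} {g₀} {g₁} {g₂} fits₀ fits₁ fits₂ =
  subst (λ t → HasEquitableTreeColoring (K₃ n) t 3) length≡
    (equitableTreeColoring n L total (4≤4k+1 (≤-trans (m≤n+m 1 (5 * g₀)) fits₀)) sizes blocks)
  where
  n = 4 * k + 1
  T₀ = partTiling k g₀
  T₁ = partTiling k g₁
  T₂ = partTiling k g₂
  L = T₀ ++ (T₁ ++ T₂)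
  total : sum L ≡ (n + n) + n
  total = begin
    sum L                               ≡⟨ sum-++ T₀ _ ⟩
    sum T₀ + sum (T₁ ++ T₂)             ≡⟨ cong (sum T₀ +_) (sum-++ T₁ T₂) ⟩
    sum T₀ + (sum T₁ + sum T₂)          ≡⟨ cong₂ _+_ (sum-partTiling k g₀ fits₀)
                                                      (cong₂ _+_ (sum-partTiling k g₁ fits₁) (sum-partTiling k g₂ fits₂)) ⟩
    n + (n + n)                         ≡⟨ +-assoc n n n ⟨
    (n + n) + n                         ∎
    where open ≡-Reasoning
  length+gs : length L + (g₀ + (g₁ + g₂)) ≡ 3 * k
  length+gs = begin
    length L + (g₀ + (g₁ + g₂))
      ≡⟨ cong (_+ (g₀ + (g₁ + g₂))) (trans (length-++ T₀) (cong (length T₀ +_) (length-++ T₁))) ⟩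
    (length T₀ + (length T₁ + length T₂)) + (g₀ + (g₁ + g₂))
      ≡⟨ interchange (length T₀) (length T₁) (length T₂) g₀ g₁ g₂ ⟩
    (length T₀ + g₀) + ((length T₁ + g₁) + (length T₂ + g₂))
      ≡⟨ cong₂ _+_ (length-partTiling k g₀ fits₀) (cong₂ _+_ (length-partTiling k g₁ fits₁) (length-partTiling k g₂ fits₂)) ⟩
    k + (k + k)
      ≡⟨ cong (λ x → k + (k + x)) (+-identityʳ k) ⟨
    3 * k ∎
    where
    open ≡-Reasoning
    interchange : ∀ a b c d e f → (a + (b + c)) + (d + (e + f)) ≡ (a + d) + ((b + e) + (c + f))
    interchange = solve-∀
  length≡ : length L ≡ 3 * k ∸ (g₀ + (g₁ + g₂))
  length≡ = trans (sym (m+n∸n≡m (length L) (g₀ + (g₁ + g₂)))) (cong (_∸ (g₀ + (g₁ + g₂))) length+gs)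
  sizes : All (λ s → s ≡ 4 ⊎ s ≡ 5) L
  sizes = ++⁺ (partTiling-sizes k g₀) (++⁺ (partTiling-sizes k g₁) (partTiling-sizes k g₂))
  blocks : AllBlocks (StarBlock n) 0 L
  blocks = partwise-starBlocks T₀ T₁ T₂ (sum-partTiling k g₀ fits₀) (sum-partTiling k g₁ fits₁)

m∸n≤o⇒m∸o≤n : ∀ m n {o} → m ∸ n ≤ o → m ∸ o ≤ n
m∸n≤o⇒m∸o≤n m n {o} m∸n≤o = m≤n+o⇒m∸n≤o m o (begin
  m            ≤⟨ m≤n+m∸n m n ⟩
  n + (m ∸ n)  ≤⟨ +-monoʳ-≤ n m∸n≤o ⟩
  n + o        ≡⟨ +-comm n o ⟩
  o + n        ∎)
  where open ≤-Reasoning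

manyColors : ∀ {k m t} → 5 * m + 1 ≤ k → 3 * k ∸ 3 * m ≤ t → t ≤ 3 * k →
              HasEquitableTreeColoring (K₃ (4 * k + 1)) t 3
manyColors {k} {m} {t} 5m+1≤k lower upper with split₃ m (m∸n≤o⇒m∸o≤n (3 * k) (3 * m) lower)
... | g₀ , g₁ , g₂ , g₀≤m , g₁≤m , g₂≤m , sum≡deficit =
  subst (λ t → HasEquitableTreeColoring (K₃ (4 * k + 1)) t 3)
        (trans (cong (3 * k ∸_) sum≡deficit) (m∸[m∸n]≡n upper))
        (partTilings-coloring {k} {g₀} {g₁} {g₂} (fits g₀≤m) (fits g₁≤m) (fits g₂≤m))
  where
  fits : ∀ {g} → g ≤ m → 5 * g + 1 ≤ k
  fits g≤m = ≤-trans (+-monoˡ-≤ 1 (*-monoʳ-≤ 5 g≤m)) 5m+1≤k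

threeRuns : ℕ → ℕ → ℕ → ℕ → List ℕ
threeRuns q c u e = replicate c (suc q) ++ (replicate u q ++ replicate e (suc q))

threeRuns-starBlocks : ∀ {k q c u e} → q ≤ 3 → 1 ≤ u → c ≤ k + k → e ≡ 0 ⊎ c ≡ k + k →
                       AllBlocks (StarBlock (4 * k + 1)) 0 (threeRuns q c u e)
threeRuns-starBlocks {k} {q} {c} {u} {e} q≤3 1≤u c≤2k e≡0∨c≡2k with m≤n⇒m<n∨m≡n q≤3
... | inj₁ q<3 = AllBlocks-fromAll (λ _ → smallBlock-star)
                   (++⁺ (replicate⁺ c q<3) (++⁺ (replicate⁺ u (<⇒≤ q<3)) (replicate⁺ e q<3)))
... | inj₂ refl = AllBlocks-++ (replicate c 4) (alignedFours k 0 c c≤2k)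
                    (AllBlocks-++ (replicate u 3) (AllBlocks-fromAll (λ _ → smallBlock-star) (replicate⁺ u ≤-refl))
                                  (lastFours e≡0∨c≡2k))
  where
  lastFours : e ≡ 0 ⊎ c ≡ k + k →
              AllBlocks (StarBlock (4 * k + 1)) (sum (replicate c 4) + sum (replicate u 3)) (replicate e 4)
  lastFours (inj₁ refl) = tt
  lastFours (inj₂ refl) = AllBlocks-avoiding _ (replicate e 4) λ b bd → inj₁ (begin
    b                                     ≤⟨ boundary≤2n bd ⟩
    (4 * k + 1) + (4 * k + 1)             ≡⟨ beyond k ⟩
    (k + k) * 4 + 2                       <⟨ +-monoʳ-< ((k + k) * 4) (≤-trans (s≤s (s≤s (s≤s z≤n))) (*-monoˡ-≤ 3 1≤u)) ⟩
    (k + k) * 4 + u * 3                   ≡⟨ cong₂ _+_ (sum-replicate (k + k) 4) (sum-replicate u 3) ⟨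
    sum (replicate (k + k) 4) + sum (replicate u 3) ∎)
    where
    open ≤-Reasoning
    boundary≤2n : ∀ {n b} → Boundary n b → b ≤ n + n
    boundary≤2n {n} (inj₁ refl) = m≤m+n n n
    boundary≤2n     (inj₂ refl) = ≤-refl
    beyond : ∀ k → (4 * k + 1) + (4 * k + 1) ≡ (k + k) * 4 + 2
    beyond = solve-∀

threeRuns-coloring : ∀ {k q c u e} → 1 ≤ k → q ≤ 3 → 1 ≤ u → c ≤ k + k → e ≡ 0 ⊎ c ≡ k + k →
                      let n = 4 * k + 1 in (n + n) + n ≡ (c + e) + q * ((c + e) + u) →
                      HasEquitableTreeColoring (K₃ n) (c + (u + e)) 3
threeRuns-coloring {k} {q} {c} {u} {e} 1≤k q≤3 1≤u c≤2k e≡0∨c≡2k total =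
  subst (λ t → HasEquitableTreeColoring (K₃ (4 * k + 1)) t 3) length≡
    (equitableTreeColoring (4 * k + 1) (threeRuns q c u e) (trans sum≡ (sym total)) (4≤4k+1 1≤k) sizes
      (threeRuns-starBlocks {k} q≤3 1≤u c≤2k e≡0∨c≡2k))
  where
  length≡ : length (threeRuns q c u e) ≡ c + (u + e)
  length≡ = trans (length-++ (replicate c (suc q)))
              (cong₂ _+_ (length-replicate c) (trans (length-++ (replicate u q)) (cong₂ _+_ (length-replicate u) (length-replicate e))))
  sum≡ : sum (threeRuns q c u e) ≡ (c + e) + q * ((c + e) + u)
  sum≡ = begin
    sum (threeRuns q c u e)                   ≡⟨ sum-++ (replicate c (suc q)) _ ⟩
    sum (replicate c (suc q)) + sum (replicate u q ++ replicate e (suc q))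
                                              ≡⟨ cong (sum (replicate c (suc q)) +_) (sum-++ (replicate u q) _) ⟩
    sum (replicate c (suc q)) + (sum (replicate u q) + sum (replicate e (suc q)))
                                              ≡⟨ cong₂ _+_ (sum-replicate c (suc q)) (cong₂ _+_ (sum-replicate u q) (sum-replicate e (suc q))) ⟩
    c * suc q + (u * q + e * suc q)           ≡⟨ regroup c u e q ⟩
    (c + e) + q * ((c + e) + u)               ∎
    where
    open ≡-Reasoning
    regroup : ∀ c u e q → c * suc q + (u * q + e * suc q) ≡ (c + e) + q * ((c + e) + u)
    regroup = solve-∀
  sizes : All (λ s → s ≡ q ⊎ s ≡ suc q) (threeRuns q c u e)
  sizes = ++⁺ (replicate⁺ c (inj₂ refl)) (++⁺ (replicate⁺ u (inj₁ refl)) (replicate⁺ e (inj₂ refl)))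

fewColors : ∀ {k t} → 1 ≤ k → 3 * k < t → HasEquitableTreeColoring (K₃ (4 * k + 1)) t 3
fewColors {k} {t@(suc _)} 1≤k 3k<t = runs (r ≤? k + k)
  where
  n = 4 * k + 1
  q = ((n + n) + n) / t
  r = ((n + n) + n) % t
  u = t ∸ r
  r+u≡t : r + u ≡ t
  r+u≡t = m+[n∸m]≡n (<⇒≤ (m%n<n ((n + n) + n) t))
  q≤3 : q ≤ 3
  q≤3 = s≤s⁻¹ (m<n*o⇒m/o<n (begin-strict
    (n + n) + n       <⟨ n<1+n _ ⟩
    suc ((n + n) + n) ≡⟨ expand k ⟩
    4 * suc (3 * k)   ≤⟨ *-monoʳ-≤ 4 3k<t ⟩
    4 * t             ∎))
    where
    open ≤-Reasoning
    expand : ∀ k → suc ((4 * k + 1 + (4 * k + 1)) + (4 * k + 1)) ≡ 4 * suc (3 * k)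
    expand = solve-∀
  runsOf : ∀ {c e} → c + e ≡ r → c ≤ k + k → e ≡ 0 ⊎ c ≡ k + k → HasEquitableTreeColoring (K₃ n) t 3
  runsOf {c} {e} c+e≡r c≤2k e≡0∨c≡2k =
    subst (λ t → HasEquitableTreeColoring (K₃ n) t 3) length≡t
      (threeRuns-coloring {k} {q} {c} {u} {e} 1≤k q≤3 (m<n⇒0<n∸m (m%n<n ((n + n) + n) t)) c≤2k e≡0∨c≡2k total)
    where
    total : (n + n) + n ≡ (c + e) + q * ((c + e) + u)
    total = begin
      (n + n) + n                   ≡⟨ m≡m%n+[m/n]*n ((n + n) + n) t ⟩
      r + q * t                     ≡⟨ cong₂ (λ a b → a + q * b) (sym c+e≡r) (sym (trans (cong (_+ u) c+e≡r) r+u≡t)) ⟩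
      (c + e) + q * ((c + e) + u)   ∎
      where open ≡-Reasoning
    length≡t : c + (u + e) ≡ t
    length≡t = trans (reorder c u e) (trans (cong (_+ u) c+e≡r) r+u≡t)
      where
      reorder : ∀ c u e → c + (u + e) ≡ (c + e) + u
      reorder = solve-∀
  runs : Dec (r ≤ k + k) → HasEquitableTreeColoring (K₃ n) t 3
  runs (yes r≤2k) = runsOf (+-identityʳ r) r≤2k (inj₁ refl)
  runs (no  r≰2k) = runsOf (m+[n∸m]≡n (<⇒≤ (≰⇒> r≰2k))) ≤-refl (inj₂ refl)

proposition3 : ∀ (k m : ℕ) → 1 ≤ k → 5 * m + 1 ≤ k →
    StrongEquitableVertexArboricity≤ (K₃ (4 * k + 1)) 3 (3 * k ∸ 3 * m)
proposition3 k m 1≤k 5m+1≤k = 3 * k ∸ 3 * m , ≤-refl , colorings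
  where
  colorings : ∀ t → 3 * k ∸ 3 * m ≤ t → HasEquitableTreeColoring (K₃ (4 * k + 1)) t 3
  colorings t lower with t ≤? 3 * k
  ... | yes upper = manyColors {k} {m} 5m+1≤k lower upper
  ... | no  t≰3k  = fewColors {k} 1≤k (≰⇒> t≰3k)
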